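{- Let $G=\langle a,b : a^{13}=b^3=e,\ ba=a^9b\rangle$, a (metacyclic) group of order $39$, each of whose elements can be written uniquely as $a^ib^j$ with $0\le i\le 12$, $0\le j\le 2$. Define the subsets \begin{align*} X_1 &= \{a,a^5,a^8,a^{12},b,a^2b,a^4b,a^3b^2,a^7b^2,a^{11}b^2\},\\ X_2 &= \{a,a^5,a^8,a^{12},b,a^4b,a^7b,a^{11}b,a^2b^2,a^4b^2,a^8b^2,a^{11}b^2\},\\ X_3 &= \{a,a^5,a^8,a^{12},b,a^4b,a^7b,a^{10}b,a^3b^2,a^4b^2,a^{10}b^2,a^{11}b^2\},\\ X_4 &= \{a^2,a^4,a^9,a^{11},b,a^4b,a^6b,a^{11}b,a^3b^2,a^5b^2,a^9b^2,a^{11}b^2\},\\ X_5 &= X_2\cup\{a^{12}b,a^3b^2\},\\ X_6 &= X_4\cup\{a^2b,a^7b^2\},\\ X_7 &= \{a^2,a^4,a^9,a^{11},a^2b,a^3b,a^6b,a^8b,a^{11}b,a^{12}b,b^2,a^3b^2,a^4b^2,a^6b^2,a^7b^2,a^{10}b^2\},\\ X_8 &= \{a^4,a^5,a^8,a^9,b,ab,a^4b,a^6b,a^8b,a^{10}b,b^2,a^2b^2,a^4b^2,a^6b^2,a^8b^2,a^{10}b^2\}. \end{align*} Then the Cayley digraph $\Gamma_i=\mathrm{Cay}(G,X_i)$ is a directed strongly regular graph with parameter set (a) $(39,10,6,1,3)$ for $i=1$; (b) $(39,12,4,3,4)$ for $i=2,3,4$; (c) $(39,14,6,5,5)$ for $i=5,6$;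 (d) $(39,16,12,7,6)$ for $i=7,8$.
   Context: For a finite group $G$ with identity $e$ and a subset $X\subseteq G$ with $e\notin X$, the Cayley digraph $\mathrm{Cay}(G,X)$ has vertex set $G$ and dart (arc) set $\{(x,y): x,y\in G,\ yx^{ -1}\in X\}$. A directed strongly regular graph (DSRG) with parameter set $(n,k,t,\lambda,\mu)$ is a directed graph on $n$ vertices without loops whose adjacency matrix $A$ satisfies $AJ=JA=kJ$ and $A^2=tI+\lambda A+\mu(J-I-A)$, where $J$ is the all-ones matrix and $I$ the identity matrix; equivalently, every vertex has in- and out-degree $k$, every vertex lies on exactly $t$ undirected edges (pairs of opposite darts), and the number of directed paths of length $2$ from a vertex $x$ to a vertex $y\neq x$ is $\lambda$ if $(x,y)$ is a dart and $\mu$ otherwise. -}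

module Defs where

open import Data.Nat using (ℕ; _+_; _*_; _∸_; _^_)
open import Data.Nat.DivMod using (_mod_)
open import Data.Fin using (Fin; toℕ) renaming (_≟_ to _≟F_)

open import Data.Product using (_×_; _,_)
open import Data.Product.Properties using (≡-dec)
open import Data.List using (List; []; _∷_; length; filter; cartesianProduct; _++_; allFin)
open import Data.Bool using (Bool; true; false; _∧_; not; T; if_then_else_)
open import Relation.Nullary using (Dec; yes; no; ¬_)
open import Relation.Nullary.Decidable using (⌊_⌋)
open import Relation.Binary.PropositionalEquality using (_≡_)
open import Relation.Binary.Definitions using (DecidableEquality)
import Data.List.Relation.Unary.Any as Any

-- The metacyclic group G = ⟨ a , b | a^13 = b^3 = e , b a = a^9 b ⟩ of
-- order 39, realised on its normal forms a^i b^j  (0 ≤ i ≤ 12, 0 ≤ j ≤ 2).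
-- Since b^j a^k = a^(9^j k) b^j, the product is
--   (a^i b^j)(a^k b^l) = a^(i + 9^j k) b^(j + l).
-- (9 has multiplicative order 3 modulo 13, so this is a group.)

G : Set
G = Fin 13 × Fin 3

ab : ℕ → ℕ → G
ab i j = (i mod 13 , j mod 3)

e : G
e = ab 0 0

_·_ : G → G → G
(i , j) · (k , l) = ab (toℕ i + 9 ^ toℕ j * toℕ k) (toℕ j + toℕ l)

-- (a^i b^j)⁻¹ = b^(-j) a^(-i) = a^(9^(3-j) (13-i)) b^(3-j)
_⁻¹ : G → G
(i , j) ⁻¹ = ab (9 ^ (3 ∸ toℕ j) * (13 ∸ toℕ i)) (3 ∸ toℕ j)

_≟G_ : DecidableEquality G
_≟G_ = ≡-dec _≟F_ _≟F_

elements : List G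
elements = cartesianProduct (allFin 13) (allFin 3)

count : (G → Bool) → ℕ
count p = length (filter (λ x → Data.Bool._≟_ (p x) true) elements)
  where import Data.Bool

_∈?_ : G → List G → Bool
x ∈? X = ⌊ Any.any? (x ≟G_) X ⌋

Cay : List G → G → G → Bool
Cay X x y = (y · (x ⁻¹)) ∈? X

-- This spells out  AJ = JA = kJ  and
-- A² = tI + λA + μ(J - I - A), together with "no loops" and n = |G|.

paths2 : (G → G → Bool) → G → G → ℕ
paths2 A x y = count (λ z → A x z ∧ A z y)

record IsDSRG (A : G → G → Bool) (n k t lam mu : ℕ) : Set where
  field
    order     : length elements ≡ n
    loopless  : ∀ x → A x x ≡ false
    outdeg    : ∀ x → count (λ y → A x y) ≡ k
    indeg     : ∀ y → count (λ x → A x y) ≡ k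
    diag      : ∀ x → paths2 A x x ≡ t
    adjacent  : ∀ x y → ¬ x ≡ y → A x y ≡ true  → paths2 A x y ≡ lam
    nonadjacent : ∀ x y → ¬ x ≡ y → A x y ≡ false → paths2 A x y ≡ mu

X₁ X₂ X₃ X₄ X₅ X₆ X₇ X₈ : List G
X₁ = ab 1 0 ∷ ab 5 0 ∷ ab 8 0 ∷ ab 12 0 ∷ ab 0 1 ∷ ab 2 1 ∷ ab 4 1
   ∷ ab 3 2 ∷ ab 7 2 ∷ ab 11 2 ∷ []
X₂ = ab 1 0 ∷ ab 5 0 ∷ ab 8 0 ∷ ab 12 0 ∷ ab 0 1 ∷ ab 4 1 ∷ ab 7 1 ∷ ab 11 1
   ∷ ab 2 2 ∷ ab 4 2 ∷ ab 8 2 ∷ ab 11 2 ∷ []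
X₃ = ab 1 0 ∷ ab 5 0 ∷ ab 8 0 ∷ ab 12 0 ∷ ab 0 1 ∷ ab 4 1 ∷ ab 7 1 ∷ ab 10 1
   ∷ ab 3 2 ∷ ab 4 2 ∷ ab 10 2 ∷ ab 11 2 ∷ []
X₄ = ab 2 0 ∷ ab 4 0 ∷ ab 9 0 ∷ ab 11 0 ∷ ab 0 1 ∷ ab 4 1 ∷ ab 6 1 ∷ ab 11 1
   ∷ ab 3 2 ∷ ab 5 2 ∷ ab 9 2 ∷ ab 11 2 ∷ []
X₅ = X₂ ++ (ab 12 1 ∷ ab 3 2 ∷ [])
X₆ = X₄ ++ (ab 2 1 ∷ ab 7 2 ∷ [])
X₇ = ab 2 0 ∷ ab 4 0 ∷ ab 9 0 ∷ ab 11 0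
   ∷ ab 2 1 ∷ ab 3 1 ∷ ab 6 1 ∷ ab 8 1 ∷ ab 11 1 ∷ ab 12 1
   ∷ ab 0 2 ∷ ab 3 2 ∷ ab 4 2 ∷ ab 6 2 ∷ ab 7 2 ∷ ab 10 2 ∷ []
X₈ = ab 4 0 ∷ ab 5 0 ∷ ab 8 0 ∷ ab 9 0
   ∷ ab 0 1 ∷ ab 1 1 ∷ ab 4 1 ∷ ab 6 1 ∷ ab 8 1 ∷ ab 10 1
   ∷ ab 0 2 ∷ ab 2 2 ∷ ab 4 2 ∷ ab 6 2 ∷ ab 8 2 ∷ ab 10 2 ∷ []

-- Right translation by x is a bijection of G taking X onto the out-neighbours of x, and
-- the factorisations y x⁻¹ = u w with u, w ∈ X onto the 2-paths x → w x → y.  Hence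
-- Cay(G, X) is directed strongly regular with parameters (39, k, t, λ, μ) as soon as
-- e ∉ X, |X| = k and X² = t e + λ X + μ (G − e − X) in ℤ[G]; for each Xᵢ this identity
-- is a finite computation of the 39 coefficients of Xᵢ², and the group axioms for the
-- normal-form multiplication are checked by enumerating G.

module Submission where

open import Defs
open import Relation.Binary.PropositionalEquality
  using (_≡_; _≗_; refl; sym; trans; subst; cong; cong₂; isEquivalence; module ≡-Reasoning)
open import Algebra.Bundles using (Group)
open import Algebra.Structures {A = G} _≡_ using (IsGroup)
import Algebra.Properties.Group as GroupProperties
open import Data.Bool using (Bool; true; false; _∧_)
import Data.Bool as Bool
open import Data.Fin.Properties using (all?)
open import Data.List using (List; []; _∷_; length; map; filter)
open import Data.List.Properties using (length-map)
open import Data.List.Membership.Propositional using (_∈_)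
open import Data.List.Membership.Propositional.Properties using (∈-map⁺; ∈-cartesianProduct⁺; ∈-allFin)
open import Data.List.Membership.Propositional.Properties.WithK using (unique∧set⇒bag)
open import Data.List.Relation.Binary.BagAndSetEquality using (∼bag⇒↭)
open import Data.List.Relation.Binary.Permutation.Propositional using (_↭_)
open import Data.List.Relation.Binary.Permutation.Propositional.Properties using (↭-length; filter-↭)
open import Data.List.Relation.Unary.Unique.Propositional using (Unique)
import Data.List.Relation.Unary.Unique.Propositional.Properties as Unique
import Data.Nat as ℕ
open import Data.Nat using (ℕ)
open import Data.Product using (_×_; _,_)
open import Function using (_∘_; mk⇔)
open import Level using (0ℓ)
open import Relation.Nullary using (Dec; ¬_; ¬?; does)
open import Relation.Nullary.Decidable using (from-yes; map′; _×-dec_; _→-dec_)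
open import Relation.Unary using (Pred; Decidable)

∀G? : ∀ {p} {P : Pred G p} → Decidable P → Dec (∀ x → P x)
∀G? P? = map′ (λ h (i , j) → h i j) (λ h i j → h (i , j)) (all? λ i → all? λ j → P? (i , j))

·-assoc : ∀ x y z → ((x · y) · z) ≡ (x · (y · z))
·-assoc = from-yes (∀G? λ x → ∀G? λ y → ∀G? λ z → ((x · y) · z) ≟G (x · (y · z)))

·-identityˡ : ∀ x → (e · x) ≡ x
·-identityˡ = from-yes (∀G? λ x → (e · x) ≟G x)

·-identityʳ : ∀ x → (x · e) ≡ x
·-identityʳ = from-yes (∀G? λ x → (x · e) ≟G x)

·-inverseˡ : ∀ x → ((x ⁻¹) · x) ≡ e
·-inverseˡ = from-yes (∀G? λ x → ((x ⁻¹) · x) ≟G e)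

·-inverseʳ : ∀ x → (x · (x ⁻¹)) ≡ e
·-inverseʳ = from-yes (∀G? λ x → (x · (x ⁻¹)) ≟G e)

·-⁻¹-isGroup : IsGroup _·_ e _⁻¹
·-⁻¹-isGroup = record
  { isMonoid = record
    { isSemigroup = record
      { isMagma = record { isEquivalence = isEquivalence ; ∙-cong = cong₂ _·_ }
      ; assoc = ·-assoc
      }
    ; identity = ·-identityˡ , ·-identityʳ
    }
  ; inverse = ·-inverseˡ , ·-inverseʳ
  ; ⁻¹-cong = cong _⁻¹
  }

·-⁻¹-group : Group 0ℓ 0ℓ
·-⁻¹-group = record { isGroup = ·-⁻¹-isGroup }

open GroupProperties ·-⁻¹-group
  using (\\-leftDividesˡ; \\-leftDividesʳ; //-rightDividesˡ; //-rightDividesʳ; ⁻¹-involutive; ⁻¹-anti-homo-∙; x∙y⁻¹≈ε⇒x≈y)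

module _ {a b p} {A : Set a} {B : Set b} {P : Pred B p} (P? : Decidable P) where

  filter-map : ∀ (f : A → B) xs → filter P? (map f xs) ≡ map f (filter (P? ∘ f) xs)
  filter-map f [] = refl
  filter-map f (x ∷ xs) with does (P? (f x))
  ... | true  = cong (f x ∷_) (filter-map f xs)
  ... | false = filter-map f xs

module _ {a p q} {A : Set a} {P : Pred A p} {Q : Pred A q} (P? : Decidable P) (Q? : Decidable Q) where

  filter-cong : (∀ x → does (P? x) ≡ does (Q? x)) → filter P? ≗ filter Q?
  filter-cong P≐Q [] = refl
  filter-cong P≐Q (x ∷ xs) with does (P? x) | does (Q? x) | P≐Q x
  ... | true  | .true  | refl = cong (x ∷_) (filter-cong P≐Q xs)
  ... | false | .false | refl = filter-cong P≐Q xs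

∈-elements : ∀ x → x ∈ elements
∈-elements (i , j) = ∈-cartesianProduct⁺ (∈-allFin i) (∈-allFin j)

elements-unique : Unique elements
elements-unique = Unique.cartesianProduct⁺ (Unique.allFin⁺ 13) (Unique.allFin⁺ 3)

map-bijection-↭ : ∀ (f f⁻ : G → G) → (∀ x → f (f⁻ x) ≡ x) → (∀ x → f⁻ (f x) ≡ x) →
                  map f elements ↭ elements
map-bijection-↭ f f⁻ f∘f⁻ f⁻∘f = ∼bag⇒↭ (unique∧set⇒bag
  (Unique.map⁺ f-injective elements-unique) elements-unique
  λ {x} → mk⇔ (λ _ → ∈-elements x) (λ _ → subst (_∈ map f elements) (f∘f⁻ x) (∈-map⁺ f (∈-elements (f⁻ x)))))
  where
  f-injective : ∀ {x y} → f x ≡ f y → x ≡ y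
  f-injective {x} {y} fx≡fy = trans (sym (f⁻∘f x)) (trans (cong f⁻ fx≡fy) (f⁻∘f y))

count-cong : ∀ {p q : G → Bool} → p ≗ q → count p ≡ count q
count-cong p≗q = cong length (filter-cong _ _ (λ x → cong (λ b → does (b Bool.≟ true)) (p≗q x)) elements)

count-∘-bijection : ∀ (f f⁻ : G → G) → (∀ x → f (f⁻ x) ≡ x) → (∀ x → f⁻ (f x) ≡ x) →
                    ∀ p → count (p ∘ f) ≡ count p
count-∘-bijection f f⁻ f∘f⁻ f⁻∘f p = begin
  length (filter (P? ∘ f) elements)         ≡⟨ length-map f (filter (P? ∘ f) elements) ⟨
  length (map f (filter (P? ∘ f) elements)) ≡⟨ cong length (filter-map P? f elements) ⟨
  length (filter P? (map f elements))       ≡⟨ ↭-length (filter-↭ P? (map-bijection-↭ f f⁻ f∘f⁻ f⁻∘f)) ⟩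
  length (filter P? elements)               ∎
  where
  open ≡-Reasoning
  P? : Decidable (λ x → p x ≡ true)
  P? x = p x Bool.≟ true

count-∘-·ʳ : ∀ a p → count (λ w → p (w · a)) ≡ count p
count-∘-·ʳ a = count-∘-bijection (_· a) (_· (a ⁻¹)) (//-rightDividesˡ a) (//-rightDividesʳ a)

count-∘-·ˡ : ∀ a p → count (λ w → p (a · w)) ≡ count p
count-∘-·ˡ a = count-∘-bijection (a ·_) ((a ⁻¹) ·_) (\\-leftDividesˡ a) (\\-leftDividesʳ a)

count-∘-⁻¹ : ∀ p → count (λ w → p (w ⁻¹)) ≡ count p
count-∘-⁻¹ = count-∘-bijection _⁻¹ _⁻¹ ⁻¹-involutive ⁻¹-involutive

-- The coefficient of g in X² in the group ring ℤ[G].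
square-coefficient : List G → G → ℕ
square-coefficient X g = count (λ w → (w ∈? X) ∧ ((g · (w ⁻¹)) ∈? X))

module _ (X : List G) where

  Cay-loop : ∀ x → Cay X x x ≡ e ∈? X
  Cay-loop x = cong (_∈? X) (·-inverseʳ x)

  Cay-outdeg : ∀ x → count (Cay X x) ≡ count (_∈? X)
  Cay-outdeg x = count-∘-·ʳ (x ⁻¹) (_∈? X)

  Cay-indeg : ∀ y → count (λ x → Cay X x y) ≡ count (_∈? X)
  Cay-indeg y = trans (count-∘-⁻¹ (λ u → (y · u) ∈? X)) (count-∘-·ˡ y (_∈? X))

  Cay-paths2 : ∀ x y → paths2 (Cay X) x y ≡ square-coefficient X (y · (x ⁻¹))
  Cay-paths2 x y = begin
    paths2 (Cay X) x y
      ≡⟨ count-∘-·ʳ x (λ z → Cay X x z ∧ Cay X z y) ⟨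
    count (λ w → Cay X x (w · x) ∧ Cay X (w · x) y)
      ≡⟨ count-cong (λ w → cong₂ (λ u v → (u ∈? X) ∧ (v ∈? X)) (//-rightDividesʳ x w) (quotient w)) ⟩
    square-coefficient X (y · (x ⁻¹))
      ∎
    where
    open ≡-Reasoning
    quotient : ∀ w → (y · ((w · x) ⁻¹)) ≡ ((y · (x ⁻¹)) · (w ⁻¹))
    quotient w = begin
      y · ((w · x) ⁻¹)       ≡⟨ cong (y ·_) (⁻¹-anti-homo-∙ w x) ⟩
      y · ((x ⁻¹) · (w ⁻¹))  ≡⟨ ·-assoc y (x ⁻¹) (w ⁻¹) ⟨
      (y · (x ⁻¹)) · (w ⁻¹)  ∎

record IsDSRGConnectionSet (X : List G) (k t lam mu : ℕ) : Set where
  field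
    identity∉ : e ∈? X ≡ false
    size      : count (_∈? X) ≡ k
    square-e  : square-coefficient X e ≡ t
    square-∈  : ∀ g → ¬ g ≡ e → g ∈? X ≡ true → square-coefficient X g ≡ lam
    square-∉  : ∀ g → ¬ g ≡ e → g ∈? X ≡ false → square-coefficient X g ≡ mu

Cay-isDSRG : ∀ {X k t lam mu} → IsDSRGConnectionSet X k t lam mu → IsDSRG (Cay X) 39 k t lam mu
Cay-isDSRG {X} S = record
  { order       = refl
  ; loopless    = λ x → trans (Cay-loop X x) identity∉
  ; outdeg      = λ x → trans (Cay-outdeg X x) size
  ; indeg       = λ y → trans (Cay-indeg X y) size
  ; diag        = λ x → trans (Cay-paths2 X x x) (trans (cong (square-coefficient X) (·-inverseʳ x)) square-e)
  ; adjacent    = λ x y x≢y xy → trans (Cay-paths2 X x y) (square-∈ _ (quotient≢e x≢y) xy)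
  ; nonadjacent = λ x y x≢y xy → trans (Cay-paths2 X x y) (square-∉ _ (quotient≢e x≢y) xy)
  }
  where
  open IsDSRGConnectionSet S
  quotient≢e : ∀ {x y} → ¬ x ≡ y → ¬ (y · (x ⁻¹)) ≡ e
  quotient≢e x≢y yx⁻¹≡e = x≢y (sym (x∙y⁻¹≈ε⇒x≈y _ _ yx⁻¹≡e))

isDSRGConnectionSet? : ∀ X k t lam mu → Dec (IsDSRGConnectionSet X k t lam mu)
isDSRGConnectionSet? X k t lam mu =
  map′ (λ (a , b , c , d , f) → record { identity∉ = a ; size = b ; square-e = c ; square-∈ = d ; square-∉ = f })
       (λ S → let open IsDSRGConnectionSet S in identity∉ , size , square-e , square-∈ , square-∉)
       ( (e ∈? X Bool.≟ false)
    ×-dec (count (_∈? X) ℕ.≟ k)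
    ×-dec (square-coefficient X e ℕ.≟ t)
    ×-dec (∀G? λ g → ¬? (g ≟G e) →-dec (g ∈? X Bool.≟ true) →-dec (square-coefficient X g ℕ.≟ lam))
    ×-dec (∀G? λ g → ¬? (g ≟G e) →-dec (g ∈? X Bool.≟ false) →-dec (square-coefficient X g ℕ.≟ mu)))

proposition4 : IsDSRG (Cay X₁) 39 10 6 1 3
    × IsDSRG (Cay X₂) 39 12 4 3 4
    × IsDSRG (Cay X₃) 39 12 4 3 4
    × IsDSRG (Cay X₄) 39 12 4 3 4
    × IsDSRG (Cay X₅) 39 14 6 5 5
    × IsDSRG (Cay X₆) 39 14 6 5 5
    × IsDSRG (Cay X₇) 39 16 12 7 6
    × IsDSRG (Cay X₈) 39 16 12 7 6
proposition4 =
    Cay-isDSRG (from-yes (isDSRGConnectionSet? X₁ 10 6 1 3))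
  , Cay-isDSRG (from-yes (isDSRGConnectionSet? X₂ 12 4 3 4))
  , Cay-isDSRG (from-yes (isDSRGConnectionSet? X₃ 12 4 3 4))
  , Cay-isDSRG (from-yes (isDSRGConnectionSet? X₄ 12 4 3 4))
  , Cay-isDSRG (from-yes (isDSRGConnectionSet? X₅ 14 6 5 5))
  , Cay-isDSRG (from-yes (isDSRGConnectionSet? X₆ 14 6 5 5))
  , Cay-isDSRG (from-yes (isDSRGConnectionSet? X₇ 16 12 7 6))
  , Cay-isDSRG (from-yes (isDSRGConnectionSet? X₈ 16 12 7 6))
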